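{- Let $G$ be a trivalent graph and $\omega \in \tau(G)$ a degree two labeling. The labeling $\omega$ is indecomposable if and only if there exists a cycle $G'$ of $G$ together with its cycle legs such that $\omega|_{G'}\in \tau(G')$ is indecomposable.
   Context: For a graph $G$, the phylogenetic semigroup $\tau(G)$ consists of graded labelings $\omega$ of the edges of $G$ by non-negative integers together with a degree $\deg(\omega)\in\mathbb{Z}_{\ge 0}$; addition is edge-wise and degrees add. For a trivalent graph $G$, $\tau(G)$ is exactly the set of $\omega=((\omega_e)_{e\in E},\deg(\omega))$ satisfying: (parity) for every inner vertex $v$ the sum of the labels of the three edges at $v$ is even, and the labels on the two leaves obtained from a cut edge agree (i.e. $\omega$ lies in the lattice $L_G^{gr}$); (non-negativity) $\omega_e\ge 0$ for all edges $e$; (triangle inequalities) $|a_v(\omega)-b_v(\omega)|\le c_v(\omega)\le a_v(\omega)+b_v(\omega)$ at each inner vertex $v$, where $a_v,b_v,c_v$ are the labels of the three edges incident to $v$; (degree inequalities) $\deg(\omega)\ge \tfrac12(a_v(\omega)+b_v(\omega)+c_v(\omega))$ for every inner vertex $v$. An element is indecomposable (a minimal generator) if it is not a sum of two elements of $\tau(G)$ of positive degree. A path in $G$ is a sequence of unrepeated edges connecting a sequence of vertices whose first and last vertex are either both leaves or equal; in the latter case it is a cycle. A cycle edge is an edge on a cycle; a cycle leg is an edge incident to a cycle edge that is not itself a cycle edge. For a cycle $G'$ of $G$ together with its cycle legs (viewed as a graph), $\omega|_{G'}$ denotes the restriction of the labeling $\omega$ to the edges of $G'$, with the same degree; it lies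 in $\tau(G')$. -}

module Defs where

open import Data.Nat using (ℕ; zero; suc; _+_; _*_; _≤_; ∣_-_∣)
open import Data.Nat.Divisibility using (_∣_)
open import Data.Fin using (Fin; zero; suc; inject₁; fromℕ; _≟_)
open import Data.Fin.Properties using (any?)
open import Data.Product using (Σ; ∃; ∃₂; _×_; _,_; proj₁; proj₂)
open import Data.Sum using (_⊎_; inj₁; inj₂)
open import Function.Definitions using (Injective)
open import Relation.Nullary using (¬_; Dec; yes; no)
open import Relation.Nullary.Decidable using (True; toWitness; fromWitness; ¬?; _×-dec_; _⊎-dec_)
open import Relation.Binary.PropositionalEquality using (_≡_; refl)

-- A graph is given by a type V of INNER vertices, a type E of edges and,
-- for every inner vertex v, the three edges at v, one for each of its
-- three "slots" (half-edges):  inc v s  for  s : Fin 3.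
-- A loop at v occupies two slots of v.  An edge end that is not attached
-- to an inner vertex is a leaf (a vertex of degree one); leaves are thus
-- implicit.

record Graph (V E : Set) : Set where
  field
    inc : V → Fin 3 → E
open Graph public

at : ∀ {V E} → Graph V E → V × Fin 3 → E
at G (v , s) = inc G v s

-- Well-formedness: an edge has two ends, so it occupies at most two
-- half-edges (the remaining ends are leaves).  Together with the encoding
-- above this says that G is a trivalent graph (all vertices of degree 1
-- or 3).
IsTrivalentGraph : ∀ {V E} → Graph V E → Set
IsTrivalentGraph {V} {E} G =
  (e : E) (p q r : V × Fin 3) → at G p ≡ e → at G q ≡ e → at G r ≡ e →
  p ≡ q ⊎ p ≡ r ⊎ q ≡ r

record Labeling (E : Set) : Set where
  constructor mkLabeling
  field
    lab : E → ℕ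
    deg : ℕ
open Labeling public

aᵥ bᵥ cᵥ : ∀ {V E} → Graph V E → Labeling E → V → ℕ
aᵥ G ω v = lab ω (inc G v zero)
bᵥ G ω v = lab ω (inc G v (suc zero))
cᵥ G ω v = lab ω (inc G v (suc (suc zero)))

-- The lattice
-- condition is the parity condition at inner vertices (labels live on the
-- edges of G itself, so the cut-edge condition holds automatically).
-- The degree inequality  deg ≥ (a+b+c)/2  is written  a+b+c ≤ 2·deg.
InTau : ∀ {V E} → Graph V E → Labeling E → Set
InTau G ω = ∀ v →
  let a = aᵥ G ω v ; b = bᵥ G ω v ; c = cᵥ G ω v in
    (2 ∣ (a + b + c))
  × (∣ a - b ∣ ≤ c)
  × (c ≤ a + b)
  × (a + b + c ≤ 2 * deg ω)

IsSum : ∀ {E} → Labeling E → Labeling E → Labeling E → Set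
IsSum {E} ω ω₁ ω₂ =
  ((e : E) → lab ω e ≡ lab ω₁ e + lab ω₂ e) × (deg ω ≡ deg ω₁ + deg ω₂)

Decomposable : ∀ {V E} → Graph V E → Labeling E → Set
Decomposable {V} {E} G ω =
  Σ (Labeling E) λ ω₁ → Σ (Labeling E) λ ω₂ →
    InTau G ω₁ × InTau G ω₂ × 1 ≤ deg ω₁ × 1 ≤ deg ω₂ × IsSum ω ω₁ ω₂

Indecomposable : ∀ {V E} → Graph V E → Labeling E → Set
Indecomposable G ω = InTau G ω × ¬ Decomposable G ω

-- the edge e connects the inner vertices v and w (via two different
-- half-edges; for v ≡ w this means e is a loop at v)
Connects : ∀ {V E} → Graph V E → E → V → V → Set
Connects G e v w =
  ∃₂ λ s t → ¬ ((v , s) ≡ (w , t)) × inc G v s ≡ e × inc G w t ≡ e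

-- A cycle: a sequence of m+1 ≥ 1 unrepeated edges e₀,…,e_m connecting a
-- sequence of vertices v₀,…,v_{m+1} with v₀ = v_{m+1}.  (Vertices of a
-- cycle have degree ≥ 2, hence are inner vertices.)
record Cycle {nV nE : ℕ} (G : Graph (Fin nV) (Fin nE)) : Set where
  field
    m      : ℕ
    edges  : Fin (suc m) → Fin nE
    verts  : Fin (suc (suc m)) → Fin nV
    unrep  : Injective _≡_ _≡_ edges
    closed : verts zero ≡ verts (fromℕ (suc m))
    conn   : ∀ i → Connects G (edges i) (verts (inject₁ i)) (verts (suc i))
open Cycle public

module _ {nV nE : ℕ} (G : Graph (Fin nV) (Fin nE)) (C : Cycle G) where

  IsCycleEdge : Fin nE → Set
  IsCycleEdge e = ∃ λ i → edges C i ≡ e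

  isCycleEdge? : ∀ e → Dec (IsCycleEdge e)
  isCycleEdge? e = any? λ i → edges C i ≟ e

  IsCycleVertex : Fin nV → Set
  IsCycleVertex v = ∃₂ λ s i → inc G v s ≡ edges C i

  isCycleVertex? : ∀ v → Dec (IsCycleVertex v)
  isCycleVertex? v = any? λ s → any? λ i → inc G v s ≟ edges C i

  IsCycleLeg : Fin nE → Set
  IsCycleLeg e = ¬ IsCycleEdge e ×
    ∃ λ v → ∃₂ λ s t → ∃ λ i → inc G v s ≡ e × inc G v t ≡ edges C i

  isCycleLeg? : ∀ e → Dec (IsCycleLeg e)
  isCycleLeg? e = ¬? (isCycleEdge? e) ×-dec
    any? λ v → any? λ s → any? λ t → any? λ i →
      (inc G v s ≟ e) ×-dec (inc G v t ≟ edges C i)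

  -- Inner vertices: the vertices of the cycle; edges: cycle edges and
  -- cycle legs (the far ends of legs not on the cycle become leaves).
  -- Membership proofs are of the form  True _  (proof-irrelevant), so
  -- these are genuine subsets of the vertices / edges of G.
  V' : Set
  V' = Σ (Fin nV) λ v → True (isCycleVertex? v)

  E' : Set
  E' = Σ (Fin nE) λ e → True (isCycleEdge? e ⊎-dec isCycleLeg? e)

  private
    incE' : (v : Fin nV) → IsCycleVertex v → (s : Fin 3) →
            IsCycleEdge (inc G v s) ⊎ IsCycleLeg (inc G v s)
    incE' v (t , i , eq) s with isCycleEdge? (inc G v s)
    ... | yes p = inj₁ p
    ... | no ¬p = inj₂ (¬p , v , s , t , i , refl , eq)

  cycleWithLegs : Graph V' E'
  cycleWithLegs = record
    { inc = λ { (v , pv) s →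
        inc G v s , fromWitness (incE' v (toWitness pv) s) } }

  restrict : Labeling (Fin nE) → Labeling E'
  restrict ω = mkLabeling (λ { (e , _) → lab ω e }) (deg ω)

-- At a vertex of a degree-two labeling ω every label is at most 2, so writing ω as a sum of
-- two degree-one labelings amounts to choosing, for each edge of label 1, the summand that
-- receives it (a label 2 splits as 1 + 1).  The vertex conditions turn these choices into a
-- system of parity equations x_e + x_f = p, one for each vertex carrying two edges of label 1,
-- and ω is indecomposable exactly when this system has no solution.  In a trivalent graph an
-- edge meets at most two of the equations, so when the equations are solved one at a time a
-- violated one can be repaired by flipping bits along a chain of equations; the only thing that
-- can stop this is a chain closing up into a cycle with inconsistent parities.  The cycle with
-- its legs carries the same equations, hence ω restricted to it is indecomposable; conversely a
-- decomposition of ω restricts to one of ω|G'.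

module Submission where

open import Defs
open import Data.Bool using (Bool; true; false; not; _xor_)
open import Data.Bool.Properties
  using (xor-comm; xor-assoc; xor-same; xor-identityʳ; xor-annihilates-not; not-distribˡ-xor; not-distribʳ-xor; ¬-not)
  renaming (_≟_ to _≟ᵇ_)
open import Data.Empty using (⊥-elim)
open import Data.Fin using (Fin; zero; suc; inject₁; fromℕ) renaming (_≟_ to _≟ᶠ_)
open import Data.Fin.Patterns using (0F; 1F; 2F)
open import Data.List using (List; []; _∷_; length; filter; allFin)
open import Data.List.Membership.Propositional using (_∈_; find; lose)
open import Data.List.Membership.Propositional.Properties using (∈-filter⁻; ∈-filter⁺; ∈-allFin)
open import Data.List.Properties using (length-filter; filter-notAll)
open import Data.List.Relation.Unary.Any using (here; there; any?)
open import Data.Nat using (ℕ; zero; suc; _+_; _*_; _∸_; _≤_; _<_; z≤n; s≤s; ∣_-_∣; _≤?_; _≡ᵇ_)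
open import Data.Nat.Divisibility using (_∣_; _∣?_)
open import Data.Nat.Properties
  using (≤-refl; ≤-trans; ≤-reflexive; +-identityʳ; +-assoc; +-comm; +-monoʳ-≤; *-cancelˡ-≤;
         m≤n+m∸n; m∸n≤∣m-n∣; ∣-∣-comm; m+[n∸m]≡n)
open import Data.Product using (Σ; ∃; ∃₂; _×_; _,_; proj₁; proj₂)
open import Data.Sum using (_⊎_; inj₁; inj₂; [_,_]′)
open import Data.Unit using (⊤; tt)
open import Data.Vec.Functional using (updateAt) renaming ([] to []ᵛ; _∷_ to _∷ᵛ_)
open import Data.Vec.Functional.Properties using (updateAt-updates; updateAt-minimal)
open import Function using (_∘_; id; const)
open import Function.Bundles using (_⇔_; mk⇔; Equivalence)
open import Relation.Nullary using (¬_; Dec; yes; no)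
open import Relation.Nullary.Decidable using (True; fromWitness; toWitness; ¬?; _×-dec_; _⊎-dec_)
open import Relation.Binary.PropositionalEquality using (_≡_; _≢_; refl; sym; trans; cong; cong₂; subst; module ≡-Reasoning)

xor≡false⇔ : ∀ p u → p xor u ≡ false ⇔ u ≡ p
xor≡false⇔ false false = mk⇔ (λ _ → refl) (λ _ → refl)
xor≡false⇔ false true  = mk⇔ (λ ()) (λ ())
xor≡false⇔ true  false = mk⇔ (λ ()) (λ ())
xor≡false⇔ true  true  = mk⇔ (λ _ → refl) (λ _ → refl)

xor-cancel-middle : ∀ a m b → (a xor m) xor (m xor b) ≡ a xor b
xor-cancel-middle a m b = begin
  (a xor m) xor (m xor b)  ≡⟨ xor-assoc a m (m xor b) ⟩
  a xor (m xor (m xor b))  ≡⟨ cong (a xor_) (sym (xor-assoc m m b)) ⟩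
  a xor ((m xor m) xor b)  ≡⟨ cong (λ u → a xor (u xor b)) (xor-same m) ⟩
  a xor b                  ∎
  where open ≡-Reasoning

-- Vertex conditions of degree-two labelings

-- InTau G ω unfolds to  ∀ v → Admissible (aᵥ G ω v) (bᵥ G ω v) (cᵥ G ω v) (deg ω).
Admissible : ℕ → ℕ → ℕ → ℕ → Set
Admissible a b c d = (2 ∣ (a + b + c)) × (∣ a - b ∣ ≤ c) × (c ≤ a + b) × (a + b + c ≤ 2 * d)

admissible? : ∀ a b c d → Dec (Admissible a b c d)
admissible? a b c d = (2 ∣? (a + b + c)) ×-dec (∣ a - b ∣ ≤? c) ×-dec (c ≤? a + b) ×-dec (a + b + c ≤? 2 * d)

≤-half : ∀ {x y d} → x ≤ y → x + y ≤ 2 * d → x ≤ d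
≤-half {x} x≤y x+y≤2d =
  *-cancelˡ-≤ 2 (≤-trans (+-monoʳ-≤ x (≤-trans (≤-reflexive (+-identityʳ x)) x≤y)) x+y≤2d)

labels≤deg : ∀ a b c {d} → Admissible a b c d → a ≤ d × b ≤ d × c ≤ d
labels≤deg a b c {d} (_ , ∣a-b∣≤c , c≤a+b , sum≤) =
  ≤-half a≤b+c (subst (_≤ 2 * d) (+-assoc a b c) sum≤) ,
  ≤-half b≤a+c (subst (_≤ 2 * d) b+[a+c]≡sum sum≤) ,
  ≤-half c≤a+b (subst (_≤ 2 * d) (+-comm (a + b) c) sum≤)
  where
  a≤b+c : a ≤ b + c
  a≤b+c = ≤-trans (m≤n+m∸n a b) (+-monoʳ-≤ b (≤-trans (m∸n≤∣m-n∣ a b) ∣a-b∣≤c))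
  b≤a+c : b ≤ a + c
  b≤a+c = ≤-trans (m≤n+m∸n b a)
            (+-monoʳ-≤ a (≤-trans (m∸n≤∣m-n∣ b a) (subst (_≤ c) (∣-∣-comm a b) ∣a-b∣≤c)))
  b+[a+c]≡sum : a + b + c ≡ b + (a + c)
  b+[a+c]≡sum = trans (cong (_+ c) (+-comm a b)) (+-assoc b a c)

m+n≡2⇒m≡1×n≡1 : ∀ {m n} → 1 ≤ m → 1 ≤ n → 2 ≡ m + n → m ≡ 1 × n ≡ 1
m+n≡2⇒m≡1×n≡1 {1} {1} _ _ _ = refl , refl
m+n≡2⇒m≡1×n≡1 {1} {suc (suc _)} _ _ ()
m+n≡2⇒m≡1×n≡1 {2} {suc _} _ _ ()
m+n≡2⇒m≡1×n≡1 {suc (suc (suc _))} {suc _} _ _ ()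

toℕ : Bool → ℕ
toℕ false = 0
toℕ true  = 1

-- Whether the first summand receives a unit of a label n when the choice bit of its edge is x.
-- Labels above 2 never occur at a vertex of a degree-two labeling.
share : ℕ → Bool → Bool
share zero          _ = false
share (suc zero)    x = x
share (suc (suc _)) _ = true

parityCheck : ℕ → ℕ → ℕ → (Fin 3 → Bool) → Bool
parityCheck a b c x = share a (x 0F) xor share b (x 1F) xor share c (x 2F)

data VertexType (a b c : ℕ) : Set where
  unconstrained : (∀ x → parityCheck a b c x ≡ false) → VertexType a b c
  parityOn      : (s t : Fin 3) → s ≢ t → (p : Bool) →
                  (∀ x → parityCheck a b c x ≡ p xor x s xor x t) → VertexType a b c

private
  classify : ∀ a b c → a ≤ 2 → b ≤ 2 → c ≤ 2 → True (admissible? a b c 2) → VertexType a b c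
  classify 0 0 0 _ _ _ _ = unconstrained λ _ → refl
  classify 0 0 1 _ _ _ ()
  classify 0 0 2 _ _ _ ()
  classify 0 1 0 _ _ _ ()
  classify 0 1 1 _ _ _ _ = parityOn 1F 2F (λ ()) false λ _ → refl
  classify 0 1 2 _ _ _ ()
  classify 0 2 0 _ _ _ ()
  classify 0 2 1 _ _ _ ()
  classify 0 2 2 _ _ _ _ = unconstrained λ _ → refl
  classify 1 0 0 _ _ _ ()
  classify 1 0 1 _ _ _ _ = parityOn 0F 2F (λ ()) false λ _ → refl
  classify 1 0 2 _ _ _ ()
  classify 1 1 0 _ _ _ _ = parityOn 0F 1F (λ ()) false λ x → cong (x 0F xor_) (xor-identityʳ (x 1F))
  classify 1 1 1 _ _ _ ()
  classify 1 1 2 _ _ _ _ = parityOn 0F 1F (λ ()) true λ x →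
    trans (cong (x 0F xor_) (xor-comm (x 1F) true)) (sym (not-distribʳ-xor (x 0F) (x 1F)))
  classify 1 2 0 _ _ _ ()
  classify 1 2 1 _ _ _ _ = parityOn 0F 2F (λ ()) true λ x → sym (not-distribʳ-xor (x 0F) (x 2F))
  classify 1 2 2 _ _ _ ()
  classify 2 0 0 _ _ _ ()
  classify 2 0 1 _ _ _ ()
  classify 2 0 2 _ _ _ _ = unconstrained λ _ → refl
  classify 2 1 0 _ _ _ ()
  classify 2 1 1 _ _ _ _ = parityOn 1F 2F (λ ()) true λ _ → refl
  classify 2 1 2 _ _ _ ()
  classify 2 2 0 _ _ _ _ = unconstrained λ _ → refl
  classify 2 2 1 _ _ _ ()
  classify 2 2 2 _ _ _ ()
  classify (suc (suc (suc _))) _ _ (s≤s (s≤s ())) _ _ _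
  classify _ (suc (suc (suc _))) _ _ (s≤s (s≤s ())) _ _
  classify _ _ (suc (suc (suc _))) _ _ (s≤s (s≤s ())) _

vertexType : ∀ a b c → Admissible a b c 2 → VertexType a b c
vertexType a b c adm with labels≤deg a b c adm
... | a≤2 , b≤2 , c≤2 = classify a b c a≤2 b≤2 c≤2 (fromWitness adm)

parityCheck-not : ∀ {a b c} → VertexType a b c → ∀ x → parityCheck a b c (not ∘ x) ≡ parityCheck a b c x
parityCheck-not (unconstrained h) x = trans (h (not ∘ x)) (sym (h x))
parityCheck-not (parityOn s t _ p h) x =
  trans (h (not ∘ x)) (trans (cong (p xor_) (xor-annihilates-not (x s) (x t))) (sym (h x)))

xor≡false⇒admissible : ∀ p q r → p xor q xor r ≡ false → Admissible (toℕ p) (toℕ q) (toℕ r) 1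
xor≡false⇒admissible false false false _ = toWitness {a? = admissible? 0 0 0 1} _
xor≡false⇒admissible false true  true  _ = toWitness {a? = admissible? 0 1 1 1} _
xor≡false⇒admissible true  false true  _ = toWitness {a? = admissible? 1 0 1 1} _
xor≡false⇒admissible true  true  false _ = toWitness {a? = admissible? 1 1 0 1} _
xor≡false⇒admissible false false true  ()
xor≡false⇒admissible false true  false ()
xor≡false⇒admissible true  false false ()
xor≡false⇒admissible true  true  true  ()

admissible⇒xor≡false : ∀ a b c → Admissible a b c 1 → (a ≡ᵇ 1) xor (b ≡ᵇ 1) xor (c ≡ᵇ 1) ≡ false
admissible⇒xor≡false a b c adm with labels≤deg a b c adm
... | a≤1 , b≤1 , c≤1 = go a b c a≤1 b≤1 c≤1 (fromWitness adm)
  where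
  go : ∀ a b c → a ≤ 1 → b ≤ 1 → c ≤ 1 → True (admissible? a b c 1) →
       (a ≡ᵇ 1) xor (b ≡ᵇ 1) xor (c ≡ᵇ 1) ≡ false
  go 0 0 0 _ _ _ _ = refl
  go 0 1 1 _ _ _ _ = refl
  go 1 0 1 _ _ _ _ = refl
  go 1 1 0 _ _ _ _ = refl
  go 0 0 1 _ _ _ ()
  go 0 1 0 _ _ _ ()
  go 1 0 0 _ _ _ ()
  go 1 1 1 _ _ _ ()
  go (suc (suc _)) _ _ (s≤s ()) _ _ _
  go _ (suc (suc _)) _ _ (s≤s ()) _ _
  go _ _ (suc (suc _)) _ _ (s≤s ()) _

share≤ : ∀ n x → toℕ (share n x) ≤ n
share≤ zero          _     = z≤n
share≤ (suc zero)    false = z≤n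
share≤ (suc zero)    true  = s≤s z≤n
share≤ (suc (suc _)) _     = s≤s z≤n

∸-share : ∀ n x → n ≤ 2 → n ∸ toℕ (share n x) ≡ toℕ (share n (not x))
∸-share 0 _     _ = refl
∸-share 1 false _ = refl
∸-share 1 true  _ = refl
∸-share 2 _     _ = refl
∸-share (suc (suc (suc _))) _ (s≤s (s≤s ()))

share-+ : ∀ {m n} → m ≤ 1 → n ≤ 1 → share (m + n) (m ≡ᵇ 1) ≡ (m ≡ᵇ 1)
share-+ {0} {0} _ _ = refl
share-+ {0} {1} _ _ = refl
share-+ {1} {0} _ _ = refl
share-+ {1} {1} _ _ = refl
share-+ {suc (suc _)} (s≤s ()) _
share-+ {_} {suc (suc _)} _ (s≤s ())

parityCheck-cong : ∀ a b c {x y} → (∀ i → x i ≡ y i) → parityCheck a b c x ≡ parityCheck a b c y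
parityCheck-cong a b c x≗y rewrite x≗y 0F | x≗y 1F | x≗y 2F = refl

parityCheck-halves : ∀ a₁ b₁ c₁ a₂ b₂ c₂ → Admissible a₁ b₁ c₁ 1 → Admissible a₂ b₂ c₂ 1 →
  parityCheck (a₁ + a₂) (b₁ + b₂) (c₁ + c₂) ((a₁ ≡ᵇ 1) ∷ᵛ (b₁ ≡ᵇ 1) ∷ᵛ (c₁ ≡ᵇ 1) ∷ᵛ []ᵛ) ≡ false
parityCheck-halves a₁ b₁ c₁ a₂ b₂ c₂ adm₁ adm₂
  with labels≤deg a₁ b₁ c₁ adm₁ | labels≤deg a₂ b₂ c₂ adm₂
... | a₁≤1 , b₁≤1 , c₁≤1 | a₂≤1 , b₂≤1 , c₂≤1
  rewrite share-+ a₁≤1 a₂≤1 | share-+ b₁≤1 b₂≤1 | share-+ c₁≤1 c₂≤1 = admissible⇒xor≡false a₁ b₁ c₁ adm₁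

module _ {V E : Set} (H : Graph V E) where

  -- A splitting chooses, for every edge of label 1, the summand that receives it.
  checkAt : Labeling E → (E → Bool) → V → Bool
  checkAt ω x v = parityCheck (aᵥ H ω v) (bᵥ H ω v) (cᵥ H ω v) (λ i → x (inc H v i))

  IsSplitting : Labeling E → (E → Bool) → Set
  IsSplitting ω x = ∀ v → checkAt ω x v ≡ false

  admissibleAt : ∀ ω {d} → InTau H ω → deg ω ≡ d → ∀ v → Admissible (aᵥ H ω v) (bᵥ H ω v) (cᵥ H ω v) d
  admissibleAt ω τ refl v = τ v

  module _ (ω : Labeling E) (deg≡2 : deg ω ≡ 2) where

    vertexTypeAt : InTau H ω → ∀ v → VertexType (aᵥ H ω v) (bᵥ H ω v) (cᵥ H ω v)
    vertexTypeAt τ v = vertexType _ _ _ (admissibleAt ω τ deg≡2 v)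

    decomposable⇒splitting : Decomposable H ω → Σ (E → Bool) (IsSplitting ω)
    decomposable⇒splitting (ω₁ , ω₂ , τ₁ , τ₂ , 1≤deg₁ , 1≤deg₂ , lab≡ , deg≡)
      with m+n≡2⇒m≡1×n≡1 1≤deg₁ 1≤deg₂ (trans (sym deg≡2) deg≡)
    ... | deg₁≡1 , deg₂≡1 = (λ e → lab ω₁ e ≡ᵇ 1) , splitting
      where
      splitting : IsSplitting ω (λ e → lab ω₁ e ≡ᵇ 1)
      splitting v rewrite lab≡ (inc H v 0F) | lab≡ (inc H v 1F) | lab≡ (inc H v 2F) =
        parityCheck-halves (aᵥ H ω₁ v) (bᵥ H ω₁ v) (cᵥ H ω₁ v) (aᵥ H ω₂ v) (bᵥ H ω₂ v) (cᵥ H ω₂ v)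
          (admissibleAt ω₁ τ₁ deg₁≡1 v) (admissibleAt ω₂ τ₂ deg₂≡1 v)

    splitting⇒decomposable : ∀ x → InTau H ω → IsSplitting ω x → Decomposable H ω
    splitting⇒decomposable x τ splitting =
      ω₁ , ω₂ , τ₁ , τ₂ , s≤s z≤n , s≤s z≤n , (λ e → sym (m+[n∸m]≡n (share≤ (lab ω e) (x e)))) , deg≡2
      where
      part : E → ℕ
      part e = toℕ (share (lab ω e) (x e))
      ω₁ ω₂ : Labeling E
      ω₁ = mkLabeling part 1
      ω₂ = mkLabeling (λ e → lab ω e ∸ part e) 1
      xᵥ : V → Fin 3 → Bool
      xᵥ v i = x (inc H v i)
      shareAt : (Bool → Bool) → V → Fin 3 → Bool
      shareAt f v i = share (lab ω (inc H v i)) (f (xᵥ v i))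
      τ₁ : InTau H ω₁
      τ₁ v = xor≡false⇒admissible (shareAt id v 0F) (shareAt id v 1F) (shareAt id v 2F) (splitting v)
      τ₂ : InTau H ω₂
      τ₂ v with labels≤deg (aᵥ H ω v) (bᵥ H ω v) (cᵥ H ω v) (admissibleAt ω τ deg≡2 v)
      ... | a≤2 , b≤2 , c≤2
        rewrite ∸-share (aᵥ H ω v) (xᵥ v 0F) a≤2
              | ∸-share (bᵥ H ω v) (xᵥ v 1F) b≤2
              | ∸-share (cᵥ H ω v) (xᵥ v 2F) c≤2
        = xor≡false⇒admissible (shareAt not v 0F) (shareAt not v 1F) (shareAt not v 2F)
            (trans (parityCheck-not (vertexTypeAt τ v) (xᵥ v)) (splitting v))

-- Binary parity systems on trivalent graphs

module ParitySystem {nV nE : ℕ} (G : Graph (Fin nV) (Fin nE)) (trivalent : IsTrivalentGraph G)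
                    (Holds : (Fin nE → Bool) → Fin nV → Set) where

  Assignment : Set
  Assignment = Fin nE → Bool

  record Constraint : Set where
    field
      vertex : Fin nV
      s t    : Fin 3
      s≢t    : s ≢ t
      parity : Bool
      holds⇔ : ∀ x → Holds x vertex ⇔ (x (inc G vertex s) xor x (inc G vertex t) ≡ parity)

    src tgt : Fin nE
    src = inc G vertex s
    tgt = inc G vertex t
  open Constraint

  Sat : Assignment → Constraint → Set
  Sat x c = x (src c) xor x (tgt c) ≡ parity c

  sat? : ∀ x c → Dec (Sat x c)
  sat? x c = x (src c) xor x (tgt c) ≟ᵇ parity c

  sat⇒holds : ∀ {x} c → Sat x c → Holds x (vertex c)
  sat⇒holds {x} c = Equivalence.from (holds⇔ c x)

  holds⇒sat : ∀ {x} c → Holds x (vertex c) → Sat x c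
  holds⇒sat {x} c = Equivalence.to (holds⇔ c x)

  sat-transfer : ∀ {x} c c′ → vertex c ≡ vertex c′ → Sat x c → Sat x c′
  sat-transfer {x} c c′ eq = holds⇒sat c′ ∘ subst (Holds x) eq ∘ sat⇒holds c

  reverse : Constraint → Constraint
  reverse c = record
    { vertex = vertex c ; s = t c ; t = s c ; s≢t = s≢t c ∘ sym ; parity = parity c
    ; holds⇔ = λ x → let open Equivalence (holds⇔ c x) in
        mk⇔ (λ h → trans (xor-comm (x (tgt c)) (x (src c))) (to h))
            (λ e → from (trans (xor-comm (x (src c)) (x (tgt c))) e)) }

  infixr 5 _◅_
  data Path : Fin nE → Fin nE → Set where
    [_] : (c : Constraint) → Path (src c) (tgt c)
    _◅_ : (c : Constraint) {e : Fin nE} → Path (tgt c) e → Path (src c) e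

  size : ∀ {a b} → Path a b → ℕ
  size [ c ]   = 0
  size (c ◅ P) = suc (size P)

  edgesOf : ∀ {a b} (P : Path a b) → Fin (suc (suc (size P))) → Fin nE
  edgesOf [ c ]   = src c ∷ᵛ tgt c ∷ᵛ []ᵛ
  edgesOf (c ◅ P) = src c ∷ᵛ edgesOf P

  verticesThen : Fin nV → ∀ {a b} (P : Path a b) → Fin (suc (suc (size P))) → Fin nV
  verticesThen w [ c ]   = vertex c ∷ᵛ w ∷ᵛ []ᵛ
  verticesThen w (c ◅ P) = vertex c ∷ᵛ verticesThen w P

  headVertex : ∀ {a b} → Path a b → Fin nV
  headVertex [ c ]   = vertex c
  headVertex (c ◅ P) = vertex c

  All : (Constraint → Set) → ∀ {a b} → Path a b → Set
  All Q [ c ]   = Q c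
  All Q (c ◅ P) = Q c × All Q P

  mapAll : ∀ {Q R : Constraint → Set} → (∀ {c} → Q c → R c) → ∀ {a b} (P : Path a b) → All Q P → All R P
  mapAll f [ c ]   q        = f q
  mapAll f (c ◅ P) (q , qs) = f q , mapAll f P qs

  All-head : ∀ {Q : Constraint → Set} {a b} (P : Path a b) → All Q P → ∃ λ c → Q c × vertex c ≡ headVertex P
  All-head [ c ]   q       = c , q , refl
  All-head (c ◅ P) (q , _) = c , q , refl

  DistinctSteps : ∀ {a b} → Path a b → Set
  DistinctSteps [ c ]   = ⊤
  DistinctSteps (c ◅ P) = vertex c ≢ headVertex P × DistinctSteps P

  DistinctEdges : ∀ {a b} → Path a b → Set
  DistinctEdges [ c ]   = src c ≢ tgt c
  DistinctEdges (c ◅ P) = (∀ i → edgesOf P i ≢ src c) × DistinctEdges P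

  parityOf : ∀ {a b} → Path a b → Bool
  parityOf [ c ]   = parity c
  parityOf (c ◅ P) = parity c xor parityOf P

  path-parity : ∀ y {a b} (P : Path a b) → All (Sat y) P → y a xor y b ≡ parityOf P
  path-parity y [ c ]   sat          = sat
  path-parity y (c ◅ P) (sat , sats) =
    trans (sym (xor-cancel-middle (y (src c)) (y (tgt c)) _)) (cong₂ _xor_ sat (path-parity y P sats))

  edges-injective : ∀ {a b} (P : Path a b) → DistinctEdges P → ∀ i j → edgesOf P i ≡ edgesOf P j → i ≡ j
  edges-injective [ c ]   _       zero       zero       _  = refl
  edges-injective [ c ]   src≢tgt zero       (suc zero) eq = ⊥-elim (src≢tgt eq)
  edges-injective [ c ]   src≢tgt (suc zero) zero       eq = ⊥-elim (src≢tgt (sym eq))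
  edges-injective [ c ]   _       (suc zero) (suc zero) _  = refl
  edges-injective (c ◅ P) _       zero       zero       _  = refl
  edges-injective (c ◅ P) (new , _) zero     (suc j)    eq = ⊥-elim (new j (sym eq))
  edges-injective (c ◅ P) (new , _) (suc i)  zero       eq = ⊥-elim (new i eq)
  edges-injective (c ◅ P) (_ , distinct) (suc i) (suc j) eq = cong suc (edges-injective P distinct i j eq)

  edges-head : ∀ {a b} (P : Path a b) → edgesOf P zero ≡ a
  edges-head [ c ]   = refl
  edges-head (c ◅ P) = refl

  verticesThen-last : ∀ w {a b} (P : Path a b) → verticesThen w P (fromℕ (suc (size P))) ≡ w
  verticesThen-last w [ c ]   = refl
  verticesThen-last w (c ◅ P) = verticesThen-last w P

  src-in-edges : ∀ {a b} (P : Path a b) → All (λ c → ∃ λ i → edgesOf P i ≡ src c) P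
  src-in-edges [ c ]   = zero , refl
  src-in-edges (c ◅ P) = (zero , refl) , mapAll (λ (i , eq) → suc i , eq) P (src-in-edges P)

  connects : ∀ w t₀ {a b} → inc G w t₀ ≡ b → (P : Path a b) → ∀ u su → inc G u su ≡ a →
             u ≢ headVertex P → DistinctSteps P → All (λ c → vertex c ≢ w) P →
             ∀ i → Connects G (edgesOf P i) ((u ∷ᵛ verticesThen w P) (inject₁ i)) (verticesThen w P i)
  connects w t₀ b≡ [ c ]   u su a≡ u≢ _ _   zero       = su , s c , u≢ ∘ cong proj₁ , a≡ , refl
  connects w t₀ b≡ [ c ]   u su a≡ _  _ c≢w (suc zero) = t c , t₀ , c≢w ∘ cong proj₁ , refl , b≡
  connects w t₀ b≡ (c ◅ P) u su a≡ u≢ _ _   zero       = su , s c , u≢ ∘ cong proj₁ , a≡ , refl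
  connects w t₀ b≡ (c ◅ P) u su a≡ _ (c≢ , steps) (_ , ≢w) (suc i) =
    connects w t₀ b≡ P (vertex c) (t c) refl c≢ steps ≢w i

  Obstruction : Cycle G → Set
  Obstruction C = ∀ x → ¬ (∀ w → IsCycleVertex G C w → Holds x w)

  loopCycle : (h : Constraint) → src h ≡ tgt h → Cycle G
  loopCycle h loop = record
    { m = 0 ; edges = λ _ → src h ; verts = λ _ → vertex h
    ; unrep = λ { {zero} {zero} _ → refl } ; closed = refl
    ; conn = λ { zero → s h , t h , s≢t h ∘ cong proj₂ , refl , sym loop } }

  loop-obstruction : ∀ h (loop : src h ≡ tgt h) x → ¬ Sat x h → Obstruction (loopCycle h loop)
  loop-obstruction h loop x ¬sat y holds =
    ¬sat (trans (xor-self x) (trans (sym (xor-self y)) (holds⇒sat h (holds (vertex h) (s h , zero , refl)))))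
    where
    xor-self : ∀ z → z (src h) xor z (tgt h) ≡ false
    xor-self z = trans (cong (λ e → z (src h) xor z e) (sym loop)) (xor-same (z (src h)))

  closeCycle : (h : Constraint) (P : Path (src h) (tgt h)) →
               DistinctSteps P → DistinctEdges P → All (λ c → vertex c ≢ vertex h) P → Cycle G
  closeCycle h P steps distinct ≢h = record
    { m = suc (size P) ; edges = edgesOf P ; verts = vertex h ∷ᵛ verticesThen (vertex h) P
    ; unrep = λ {i} {j} → edges-injective P distinct i j
    ; closed = sym (verticesThen-last (vertex h) P)
    ; conn = connects (vertex h) (t h) refl P (vertex h) (s h) refl h≢head steps ≢h }
    where
    h≢head : vertex h ≢ headVertex P
    h≢head eq with All-head P ≢h
    ... | c , c≢h , c≡head = c≢h (trans c≡head (sym eq))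

  closed-obstruction : ∀ h (P : Path (src h) (tgt h)) steps distinct ≢h x →
                       ¬ Sat x h → All (Sat x) P → Obstruction (closeCycle h P steps distinct ≢h)
  closed-obstruction h P steps distinct ≢h x ¬sat sats y holds =
    ¬sat (trans (path-parity x P sats) (trans (sym (path-parity y P satsʸ)) satʸ))
    where
    satʸ : Sat y h
    satʸ = holds⇒sat h (holds (vertex h) (s h , zero , sym (edges-head P)))
    satsʸ : All (Sat y) P
    satsʸ = mapAll (λ {c} (i , eq) → holds⇒sat c (holds (vertex c) (s c , i , sym eq))) P (src-in-edges P)

  Solves : List Constraint → Assignment → Set
  Solves L x = ∀ {c} → c ∈ L → Sat x c

  Constrained : List Constraint → Fin nV → Set
  Constrained L w = ∃ λ c → c ∈ L × vertex c ≡ w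

  -- By trivalence a free edge occurs at most once at the vertices constrained by L,
  -- so changing its bit affects at most one constraint of L.
  Free : List Constraint → Fin nE → Set
  Free L e = ∃₂ λ u su → ¬ Constrained L u × inc G u su ≡ e

  free-occurrences-coincide : ∀ {L e w₁ k₁ w₂ k₂} → Free L e →
    Constrained L w₁ → inc G w₁ k₁ ≡ e → Constrained L w₂ → inc G w₂ k₂ ≡ e → (w₁ , k₁) ≡ (w₂ , k₂)
  free-occurrences-coincide {L} {e} {w₁} {k₁} {w₂} {k₂} (u , su , free , u≡) c₁ e₁ c₂ e₂
    with trivalent e (u , su) (w₁ , k₁) (w₂ , k₂) u≡ e₁ e₂
  ... | inj₁ eq        = ⊥-elim (free (subst (Constrained L) (sym (cong proj₁ eq)) c₁))
  ... | inj₂ (inj₁ eq) = ⊥-elim (free (subst (Constrained L) (sym (cong proj₁ eq)) c₂))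
  ... | inj₂ (inj₂ eq) = eq

  dropAt : Fin nV → List Constraint → List Constraint
  dropAt w = filter (λ c → ¬? (vertex c ≟ᶠ w))

  ∈-dropAt⁻ : ∀ {w L c} → c ∈ dropAt w L → c ∈ L × vertex c ≢ w
  ∈-dropAt⁻ {w} = ∈-filter⁻ (λ c → ¬? (vertex c ≟ᶠ w))

  ∈-dropAt⁺ : ∀ {w L c} → c ∈ L → vertex c ≢ w → c ∈ dropAt w L
  ∈-dropAt⁺ {w} = ∈-filter⁺ (λ c → ¬? (vertex c ≟ᶠ w))

  constrained-dropAt⁻ : ∀ {w L u} → Constrained (dropAt w L) u → Constrained L u × u ≢ w
  constrained-dropAt⁻ {w} {L} (c , c∈ , refl) with ∈-dropAt⁻ {w} {L} c∈
  ... | c∈L , c≢w = (c , c∈L , refl) , c≢w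

  dropAt-unconstrained : ∀ w L → ¬ Constrained (dropAt w L) w
  dropAt-unconstrained w L constrained = proj₂ (constrained-dropAt⁻ {w} {L} constrained) refl

  free-dropAt : ∀ {w L e} → Free L e → Free (dropAt w L) e
  free-dropAt {w} {L} (u , su , free , u≡) = u , su , free ∘ proj₁ ∘ constrained-dropAt⁻ {w} {L} , u≡

  solves-dropAt : ∀ {w L x} → Solves L x → Solves (dropAt w L) x
  solves-dropAt {w} {L} sol = sol ∘ proj₁ ∘ ∈-dropAt⁻ {w} {L}

  length-dropAt< : ∀ {w L} → Constrained L w → length (dropAt w L) < length L
  length-dropAt< {w} {L} (c , c∈ , eq) = filter-notAll (λ c → ¬? (vertex c ≟ᶠ w)) L (lose c∈ (λ ≢ → ≢ eq))

  length-dropAt≤ : ∀ w L → length (dropAt w L) ≤ length L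
  length-dropAt≤ w = length-filter (λ c → ¬? (vertex c ≟ᶠ w))

  _[_]≔_ : Assignment → Fin nE → Bool → Assignment
  x [ a ]≔ v = updateAt x a (const v)

  sat-≔ : ∀ {x a v} c → src c ≢ a → tgt c ≢ a → Sat x c → Sat (x [ a ]≔ v) c
  sat-≔ {x} {a} c src≢a tgt≢a =
    trans (cong₂ _xor_ (updateAt-minimal (src c) a x src≢a) (updateAt-minimal (tgt c) a x tgt≢a))

  edges-constrained : ∀ {L a b} (P : Path a b) → All (Constrained L ∘ vertex) P →
                      ∀ i → ∃₂ λ w k → Constrained L w × inc G w k ≡ edgesOf P i
  edges-constrained [ c ]   q       zero       = vertex c , s c , q , refl
  edges-constrained [ c ]   q       (suc zero) = vertex c , t c , q , refl
  edges-constrained (c ◅ P) (q , _) zero       = vertex c , s c , q , refl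
  edges-constrained (c ◅ P) (_ , qs) (suc i)   = edges-constrained P qs i

  data FlipResult (L : List Constraint) (x : Assignment) (a b : Fin nE) : Set where
    flipped : ∀ x′ → Solves L x′ → x′ a ≡ not (x a) → x′ b ≡ x b → FlipResult L x a b
    blocked : (P : Path a b) → All (λ c → Constrained L (vertex c) × Sat x c) P →
              DistinctSteps P → DistinctEdges P → FlipResult L x a b

  module _ {L : List Constraint} (c : Constraint) (c-in : Constrained L (vertex c)) (free : Free L (src c)) where

    private
      L′ : List Constraint
      L′ = dropAt (vertex c) L

    free-src≢tgt : src c ≢ tgt c
    free-src≢tgt eq = s≢t c (cong proj₂ (free-occurrences-coincide free c-in refl c-in (sym eq)))

    free-src-absent : ∀ {w k} → Constrained L′ w → inc G w k ≢ src c
    free-src-absent w-in eq with constrained-dropAt⁻ {vertex c} {L} w-in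
    ... | w-inL , w≢c = w≢c (sym (cong proj₁ (free-occurrences-coincide free c-in refl w-inL eq)))

    solves-reflip : ∀ {x x″} → Sat x c → Solves L′ x″ → x″ (tgt c) ≡ not (x (tgt c)) →
                    Solves L (x″ [ src c ]≔ not (x (src c)))
    solves-reflip {x} {x″} sat sol″ x″tgt {c′} c′∈ with vertex c′ ≟ᶠ vertex c
    ... | yes same = sat-transfer {x*} c c′ (sym same) sat*
      where
      x* : Assignment
      x* = x″ [ src c ]≔ not (x (src c))
      sat* : Sat x* c
      sat* = trans (cong₂ _xor_ (updateAt-updates (src c) x″)
                     (trans (updateAt-minimal (tgt c) (src c) x″ (free-src≢tgt ∘ sym)) x″tgt))
                   (trans (xor-annihilates-not (x (src c)) (x (tgt c))) sat)
    ... | no other = sat-≔ {x″} c′ (free-src-absent c′-in) (free-src-absent c′-in) (sol″ c′∈′)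
      where
      c′∈′ : c′ ∈ L′
      c′∈′ = ∈-dropAt⁺ {vertex c} {L} c′∈ other
      c′-in : Constrained L′ (vertex c′)
      c′-in = c′ , c′∈′ , refl

    blocked-◅ : ∀ {x b} → Sat x c → (P : Path (tgt c) b) → All (λ c′ → Constrained L′ (vertex c′) × Sat x c′) P →
                DistinctSteps P → DistinctEdges P → FlipResult L x (src c) b
    blocked-◅ sat P inL′ steps distinct =
      blocked (c ◅ P)
              ((c-in , sat) , mapAll (λ (w-in , sat′) → proj₁ (constrained-dropAt⁻ {vertex c} {L} w-in) , sat′) P inL′)
              (c≢head , steps) (fresh , distinct)
      where
      c≢head : vertex c ≢ headVertex P
      c≢head eq with All-head P inL′
      ... | _ , (w-in , _) , ≡head = proj₂ (constrained-dropAt⁻ {vertex c} {L} w-in) (trans ≡head (sym eq))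
      fresh : ∀ i → edgesOf P i ≢ src c
      fresh i eq with edges-constrained P (mapAll proj₁ P inL′) i
      ... | w , k , w-in , ≡edge = free-src-absent w-in (trans ≡edge eq)

  -- flip propagates a change of the bit of a along the constraints it meets; the change
  -- either dies out before b or is blocked by a path of constraints from a to b.
  mutual
    flip : ∀ n L → length L < n → ∀ x → Solves L x →
           ∀ a b → a ≢ b → Free L a → Free L b → FlipResult L x a b
    flip (suc n) L (s≤s len≤n) x sol a b a≢b free-a free-b
      with any? (λ c → (src c ≟ᶠ a) ⊎-dec (tgt c ≟ᶠ a)) L
    ... | no untouched =
      flipped (x [ a ]≔ not (x a)) sol′ (updateAt-updates a x) (updateAt-minimal b a x (a≢b ∘ sym))
      where
      sol′ : Solves L (x [ a ]≔ not (x a))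
      sol′ {c} c∈ = sat-≔ {x} c (untouched ∘ lose c∈ ∘ inj₁) (untouched ∘ lose c∈ ∘ inj₂) (sol c∈)
    ... | yes touched with find touched
    ...   | c , c∈ , inj₁ refl =
      flipVia n L len≤n x sol c (c , c∈ , refl) (sol c∈) b a≢b free-a free-b
    ...   | c , c∈ , inj₂ refl =
      flipVia n L len≤n x sol (reverse c) (c , c∈ , refl) (trans (xor-comm (x (tgt c)) (x (src c))) (sol c∈))
              b a≢b free-a free-b

    flipVia : ∀ n L → length L ≤ n → ∀ x → Solves L x → ∀ c → Constrained L (vertex c) → Sat x c →
              ∀ b → src c ≢ b → Free L (src c) → Free L b → FlipResult L x (src c) b
    flipVia n L len≤n x sol c c-in sat b src≢b free-src free-b with tgt c ≟ᶠ b
    ... | yes refl = blocked [ c ] (c-in , sat) tt src≢b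
    ... | no tgt≢b
      with flip n (dropAt (vertex c) L) (≤-trans (length-dropAt< c-in) len≤n)
                x (solves-dropAt {vertex c} {L} {x} sol)
                (tgt c) b tgt≢b (vertex c , t c , dropAt-unconstrained (vertex c) L , refl)
                (free-dropAt {vertex c} {L} free-b)
    ...   | flipped x″ sol″ x″tgt x″b =
      flipped (x″ [ src c ]≔ not (x (src c))) (solves-reflip c c-in free-src {x} sat sol″ x″tgt)
              (updateAt-updates (src c) x″) (trans (updateAt-minimal b (src c) x″ (src≢b ∘ sym)) x″b)
    ...   | blocked P inL′ steps distinct = blocked-◅ c c-in free-src sat P inL′ steps distinct

  Outcome : List Constraint → Set
  Outcome L = Σ Assignment (Solves L) ⊎ Σ (Cycle G) Obstruction

  solves-∷ : ∀ {h T x} → Solves (dropAt (vertex h) T) x → Sat x h → Solves (h ∷ T) x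
  solves-∷             sol sat (here refl) = sat
  solves-∷ {h} {T} {x} sol sat {c} (there c∈) with vertex c ≟ᶠ vertex h
  ... | yes same  = sat-transfer {x} h c (sym same) sat
  ... | no  other = sol (∈-dropAt⁺ {vertex h} {T} c∈ other)

  flip-sat : ∀ {x x′} h → ¬ Sat x h → x′ (src h) ≡ not (x (src h)) → x′ (tgt h) ≡ x (tgt h) → Sat x′ h
  flip-sat {x} h ¬sat src≡ tgt≡ =
    trans (cong₂ _xor_ src≡ tgt≡)
          (trans (sym (not-distribˡ-xor (x (src h)) (x (tgt h)))) (sym (¬-not (¬sat ∘ sym))))

  -- If the constraints away from the vertex of h are solved and h is violated, flipping the
  -- source of h while keeping its target either repairs h or closes a cycle through h.
  solve : ∀ n L → length L < n → Outcome L
  solve (suc n) []      _ = inj₁ (const false , λ ())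
  solve (suc n) (h ∷ T) (s≤s len≤n)
    with solve n (dropAt (vertex h) T) (≤-trans (s≤s (length-dropAt≤ (vertex h) T)) len≤n)
  ... | inj₂ obstructed = inj₂ obstructed
  ... | inj₁ (x , sol) with sat? x h
  ...   | yes sat = inj₁ (x , solves-∷ {h} {T} {x} sol sat)
  ...   | no ¬sat with src h ≟ᶠ tgt h
  ...     | yes loop = inj₂ (loopCycle h loop , loop-obstruction h loop x ¬sat)
  ...     | no src≢tgt
    with flip (suc (length (dropAt (vertex h) T))) (dropAt (vertex h) T) ≤-refl x sol (src h) (tgt h) src≢tgt
              (vertex h , s h , dropAt-unconstrained (vertex h) T , refl)
              (vertex h , t h , dropAt-unconstrained (vertex h) T , refl)
  ...       | flipped x′ sol′ src≡ tgt≡ =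
    inj₁ (x′ , solves-∷ {h} {T} {x′} sol′ (flip-sat {x} {x′} h ¬sat src≡ tgt≡))
  ...       | blocked P inT′ steps distinct =
    inj₂ (closeCycle h P steps distinct ≢h ,
          closed-obstruction h P steps distinct ≢h x ¬sat (mapAll proj₂ P inT′))
    where
    ≢h : All (λ c → vertex c ≢ vertex h) P
    ≢h = mapAll (λ (c-in , _) → proj₂ (constrained-dropAt⁻ {vertex h} {T} c-in)) P inT′

  Binary : Set
  Binary = ∀ w → (∀ x → Holds x w) ⊎ Σ Constraint (λ c → vertex c ≡ w)

  module _ (binary : Binary) where

    constraints : List (Fin nV) → List Constraint
    constraints []       = []
    constraints (w ∷ ws) with binary w
    ... | inj₁ _       = constraints ws
    ... | inj₂ (c , _) = c ∷ constraints ws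

    covered : ∀ ws {w} → w ∈ ws → (∀ x → Holds x w) ⊎ Constrained (constraints ws) w
    covered (w ∷ ws) (here refl) with binary w
    ... | inj₁ trivial   = inj₁ trivial
    ... | inj₂ (c , c≡w) = inj₂ (c , here refl , c≡w)
    covered (w′ ∷ ws) (there w∈) with binary w′ | covered ws w∈
    ... | inj₁ _ | covering            = covering
    ... | inj₂ _ | inj₁ trivial        = inj₁ trivial
    ... | inj₂ _ | inj₂ (c , c∈ , c≡w) = inj₂ (c , there c∈ , c≡w)

    solvable⊎obstructed : Σ Assignment (λ x → ∀ w → Holds x w) ⊎ Σ (Cycle G) Obstruction
    solvable⊎obstructed with solve (suc (length (constraints (allFin nV)))) (constraints (allFin nV)) ≤-refl
    ... | inj₂ obstructed = inj₂ obstructed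
    ... | inj₁ (x , sol)  = inj₁ (x , holds)
      where
      holds : ∀ w → Holds x w
      holds w with covered (allFin nV) (∈-allFin w)
      ... | inj₁ trivial         = trivial x
      ... | inj₂ (c , c∈ , refl) = sat⇒holds c (sol c∈)

-- Cycles with legs

module _ {nV nE : ℕ} (G : Graph (Fin nV) (Fin nE)) (C : Cycle G) where

  restrict-InTau : ∀ ω → InTau G ω → InTau (cycleWithLegs G C) (restrict G C ω)
  restrict-InTau ω τ (w , _) = τ w

  restrict-decomposable : ∀ ω → Decomposable G ω → Decomposable (cycleWithLegs G C) (restrict G C ω)
  restrict-decomposable ω (ω₁ , ω₂ , τ₁ , τ₂ , 1≤deg₁ , 1≤deg₂ , lab≡ , deg≡) =
    restrict G C ω₁ , restrict G C ω₂ , restrict-InTau ω₁ τ₁ , restrict-InTau ω₂ τ₂ , 1≤deg₁ , 1≤deg₂ ,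
    (λ (e , _) → lab≡ e) , deg≡

  private
    whenTrue : {P : Set} (d : Dec P) → (True d → Bool) → Bool
    whenTrue (yes _) f = f _
    whenTrue (no _)  _ = false

    whenTrue-≡ : {P : Set} (d : Dec P) (f : True d → Bool) (t : True d) → whenTrue d f ≡ f t
    whenTrue-≡ (yes _) f _ = refl

  extend : (E' G C → Bool) → Fin nE → Bool
  extend x e = whenTrue (isCycleEdge? G C e ⊎-dec isCycleLeg? G C e) (λ e∈ → x (e , e∈))

  extend-restricts : ∀ x (e : E' G C) → extend x (proj₁ e) ≡ x e
  extend-restricts x (e , e∈) =
    whenTrue-≡ (isCycleEdge? G C e ⊎-dec isCycleLeg? G C e) (λ e∈ → x (e , e∈)) e∈

  extend-splitting : ∀ ω x → IsSplitting (cycleWithLegs G C) (restrict G C ω) x →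
                     ∀ w → IsCycleVertex G C w → checkAt G ω (extend x) w ≡ false
  extend-splitting ω x splitting w w∈ =
    trans (parityCheck-cong (aᵥ G ω w) (bᵥ G ω w) (cᵥ G ω w) (λ i → extend-restricts x (inc G′ W i)))
          (splitting W)
    where
    G′ : Graph (V' G C) (E' G C)
    G′ = cycleWithLegs G C
    W : V' G C
    W = w , fromWitness w∈

module _ {nV nE : ℕ} (G : Graph (Fin nV) (Fin nE)) (trivalent : IsTrivalentGraph G) (ω : Labeling (Fin nE)) where

  open ParitySystem G trivalent (λ x w → checkAt G ω x w ≡ false)

  splitting-binary : InTau G ω → deg ω ≡ 2 → Binary
  splitting-binary τ deg≡2 w with vertexTypeAt G ω deg≡2 τ w
  ... | unconstrained trivial = inj₁ λ x → trivial (λ i → x (inc G w i))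
  ... | parityOn s t s≢t p check≡ = inj₂ (constraint , refl)
    where
    constraint : Constraint
    constraint = record
      { vertex = w ; s = s ; t = t ; s≢t = s≢t ; parity = p
      ; holds⇔ = λ x → let open Equivalence (xor≡false⇔ p (x (inc G w s) xor x (inc G w t))) in
          mk⇔ (λ holds → to (trans (sym (check≡ (x ∘ inc G w))) holds))
              (λ sat → trans (check≡ (x ∘ inc G w)) (from sat)) }

proposition4p2 : {nV nE : ℕ} (G : Graph (Fin nV) (Fin nE)) →
    IsTrivalentGraph G →
    (ω : Labeling (Fin nE)) → InTau G ω → deg ω ≡ 2 →
    Indecomposable G ω ⇔
      ∃ λ (C : Cycle G) → Indecomposable (cycleWithLegs G C) (restrict G C ω)
proposition4p2 {nE = nE} G trivalent ω τ deg≡2 = mk⇔ forward backward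
  where
  open ParitySystem G trivalent (λ x w → checkAt G ω x w ≡ false)

  forward : Indecomposable G ω → ∃ λ C → Indecomposable (cycleWithLegs G C) (restrict G C ω)
  forward (_ , indecomposable) =
    [ ⊥-elim ∘ noSplitting , indecomposableOn ]′
      (solvable⊎obstructed (splitting-binary G trivalent ω τ deg≡2))
    where
    noSplitting : ¬ Σ (Fin nE → Bool) (IsSplitting G ω)
    noSplitting (x , splitting) = indecomposable (splitting⇒decomposable G ω deg≡2 x τ splitting)

    indecomposableOn : Σ (Cycle G) Obstruction → ∃ λ C → Indecomposable (cycleWithLegs G C) (restrict G C ω)
    indecomposableOn (C , obstructed) = C , restrict-InTau G C ω τ , λ decomposable →
      let x , splitting = decomposable⇒splitting (cycleWithLegs G C) (restrict G C ω) deg≡2 decomposable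
      in obstructed (extend G C x) (extend-splitting G C ω x splitting)

  backward : ∃ (λ C → Indecomposable (cycleWithLegs G C) (restrict G C ω)) → Indecomposable G ω
  backward (C , _ , indecomposable) = τ , indecomposable ∘ restrict-decomposable G C ω
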